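{- Let $N,q,t\ge 2$ and $w_1,\dots,w_t\ge 1$ be positive integers with $q\ge t$, and put $u=\sum_{i=1}^t w_i$. Let $1\le r\le u-1$ be the integer with $N\equiv r \pmod{u-1}$. Suppose there exists an $SHF(N;n,q,\{w_1,\ldots,w_t\})$. If $C(\lfloor N/(u-1)\rfloor,q,\{w_1,\ldots,w_t\})\ge u$, then $$n\le r\,q^{\lceil N/(u-1)\rceil}+(u-1-r)\,q^{\lfloor N/(u-1)\rfloor}.$$
   Context: An $(N;n,q)$-hash family is a set $\mathcal{F}$ of $N$ functions $f:X\to Y$ where $|X|=n$, $|Y|=q$. A function $f$ separates pairwise disjoint subsets $C_1,\dots,C_t\subseteq X$ if the images $f(C_1),\dots,f(C_t)$ are pairwise disjoint. An $(N;n,q)$-hash family is an $SHF(N;n,q,\{w_1,\ldots,w_t\})$ (separating hash family of type $\{w_1,\dots,w_t\}$) if for all pairwise disjoint $C_1,\dots,C_t\subseteq X$ with $|C_i|=w_i$ there is some $f\in\mathcal{F}$ separating $C_1,\dots,C_t$. $C(N,q,\{w_1,\ldots,w_t\})$ denotes the maximum $n$ for which an $SHF(N;n,q,\{w_1,\ldots,w_t\})$ exists. -}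

module Defs where

open import Data.Nat using (ℕ; _+_; _∸_; NonZero; _/_)
open import Data.Fin using (Fin)
open import Data.Fin.Subset using (Subset; _∈_; ∣_∣)
open import Data.Vec.Functional using (Vector; foldr)
open import Data.Product using (Σ; _×_; ∃)
open import Relation.Binary.PropositionalEquality using (_≡_; _≢_)
open import Relation.Nullary using (¬_)

HashFamily : ℕ → ℕ → ℕ → Set
HashFamily N n q = Fin N → Fin n → Fin q

sumV : {t : ℕ} → Vector ℕ t → ℕ
sumV w = foldr _+_ 0 w

PairwiseDisjoint : {n t : ℕ} → Vector (Subset n) t → Set
PairwiseDisjoint {n} {t} C =
  (i j : Fin t) → i ≢ j → (x : Fin n) → x ∈ C i → ¬ (x ∈ C j)

HasSizes : {n t : ℕ} → Vector (Subset n) t → Vector ℕ t → Set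
HasSizes {n} {t} C w = (i : Fin t) → ∣ C i ∣ ≡ w i

Separates : {n q t : ℕ} → (Fin n → Fin q) → Vector (Subset n) t → Set
Separates {n} {q} {t} f C =
  (i j : Fin t) → i ≢ j → (x y : Fin n) → x ∈ C i → y ∈ C j → f x ≢ f y

IsSHF : {N n q t : ℕ} → HashFamily N n q → Vector ℕ t → Set
IsSHF {N} {n} {q} {t} F w =
  (C : Vector (Subset n) t) → PairwiseDisjoint C → HasSizes C w →
  ∃ λ (k : Fin N) → Separates (F k) C

ceilDiv : (a b : ℕ) .{{_ : NonZero b}} → ℕ
ceilDiv a b = (a + (b ∸ 1)) / b

module Submission where

-- An SHF(N; n, q, {w_1, ..., w_t}) with N = b_1 + ... + b_{u-1} rows, u = w_1 + ... + w_t,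
-- has n ≤ q^b_1 + ... + q^b_{u-1}; Theorem 1.6 is the case of the most balanced split of the
-- N rows into u - 1 blocks, r blocks of ⌈N/(u-1)⌉ rows and u - 1 - r of ⌊N/(u-1)⌋ rows.
--
-- The bound is proved for SHFs on a subset P of the points, by induction on the blocks. Map
-- each point to its code, the tuple of values of the first block, in Fin (q ^ b_1). Choosing
-- one canonical representative per code, P consists of at most q ^ b_1 representatives and
-- the remaining duplicates. The other rows form an SHF on the duplicates for the type with
-- one element less (in a part i, with another part k still nonempty): extend a configuration
-- of duplicates by the representative of a point of part k, placed in part i; a separating
-- row cannot lie in the first block, where the two points agree. When one element is left,
-- zero rows are left and no duplicate can exist.

open import Defs
open import Data.Nat using (ℕ; zero; suc; _+_; _*_; _∸_; _^_; _≤_; _<_; _/_; _%_; NonZero; >-nonZero; z≤n; s≤s; pred)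
open import Data.Nat.Properties
  using (≤-refl; ≤-trans; ≤-reflexive; ≤-pred; <-trans; n<1+n; pred[n]≤n; n≤0⇒n≡0; m≤m+n; m≤n+m;
         +-mono-≤; +-monoˡ-≤; +-monoʳ-≤; +-suc; +-identityʳ; *-comm; suc-injective; suc-pred;
         m+[n∸m]≡n; n∸n≡0; m≤n⇒m<n∨m≡n; +-commutativeSemigroup; module ≤-Reasoning)
open import Algebra.Properties.CommutativeSemigroup +-commutativeSemigroup using (interchange)
open import Data.Nat.DivMod using (m≡m%n+[m/n]*n; m<n⇒m%n≡m; n%n≡0; m<n⇒m/n≡0; m*n/n≡m; +-distrib-/-∣ˡ)
open import Data.Nat.Divisibility using (n∣m*n)
open import Data.Nat.ListAction using (sum)
open import Data.Nat.ListAction.Properties using (sum-++)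
open import Data.Nat.Tactic.RingSolver using (solve-∀)
open import Data.Bool using (Bool; true; false; T; if_then_else_; _∧_; not)
open import Data.Bool.Properties using (T-∧; T?)
open import Data.Fin using (Fin; zero; suc; _≟_; _↑ˡ_; _↑ʳ_; splitAt; funToFin; finToFun)
import Data.Fin.Properties as Fin
open import Data.Fin.Subset using (Subset; _∈_; _∉_; ∣_∣; ⊥; ⁅_⁆; _∪_; inside; outside)
open import Data.Fin.Subset.Properties
  using (x∈⁅x⁆; x∈⁅y⁆⇒x≡y; x∈p∪q⁻; x∈p∪q⁺; ∪-identityʳ; ∉⊥; ∣⊥∣≡0; nonempty?; Empty-unique)
open import Data.Vec using (_∷_; here; there)
open import Data.Vec.Functional using (Vector; updateAt)
open import Data.Vec.Functional.Properties using (updateAt-updates; updateAt-minimal)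
open import Data.List using (List; []; _∷_; length; replicate; _++_; map)
open import Data.List.Properties using (length-++; length-replicate; map-++; map-replicate)
open import Data.Product using (Σ; _×_; ∃; _,_; proj₁; proj₂)
open import Data.Sum using (_⊎_; inj₁; inj₂)
open import Function using (_∘_)
open import Function.Bundles using (Equivalence)
open import Relation.Binary.PropositionalEquality
  using (_≡_; _≢_; refl; sym; trans; cong; cong₂; subst; module ≡-Reasoning)
open import Relation.Nullary using (¬_; Dec; yes; no; contradiction)
open import Relation.Nullary.Decidable using (isYes; _×-dec_; toWitness; toWitnessFalse)

indicator : Bool → ℕ
indicator b = if b then 1 else 0

count : {n : ℕ} → (Fin n → Bool) → ℕ
count {zero}  P = 0
count {suc n} P = indicator (P zero) + count (P ∘ suc)

count-all : (n : ℕ) → count {n} (λ _ → true) ≡ n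
count-all zero    = refl
count-all (suc n) = cong suc (count-all n)

count-none : {n : ℕ} (P : Fin n → Bool) → (∀ x → ¬ T (P x)) → count P ≡ 0
count-none {zero}  P none = refl
count-none {suc n} P none with P zero in p₀
... | true  = contradiction (subst T (sym p₀) _) (none zero)
... | false = count-none (P ∘ suc) (none ∘ suc)

indicator-cover : (p r s : Bool) → (T p → T r ⊎ T s) → indicator p ≤ indicator r + indicator s
indicator-cover false r     s     _     = z≤n
indicator-cover true  true  s     _     = s≤s z≤n
indicator-cover true  false true  _     = s≤s z≤n
indicator-cover true  false false cover with cover _
... | inj₁ ()
... | inj₂ ()

count-cover : {n : ℕ} (P R S : Fin n → Bool) → (∀ x → T (P x) → T (R x) ⊎ T (S x)) →
  count P ≤ count R + count S
count-cover {zero}  P R S cover = z≤n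
count-cover {suc n} P R S cover = ≤-trans
  (+-mono-≤ (indicator-cover (P zero) (R zero) (S zero) (cover zero))
            (count-cover (P ∘ suc) (R ∘ suc) (S ∘ suc) (cover ∘ suc)))
  (≤-reflexive (interchange (indicator (R zero)) (indicator (S zero)) (count (R ∘ suc)) (count (S ∘ suc))))

Enumeration : {n : ℕ} → (Fin n → Bool) → Set
Enumeration {n} P = Σ (Fin (count P) → Fin n) λ e → (∀ i → T (P (e i))) × (∀ {i j} → e i ≡ e j → i ≡ j)

enumerate : {n : ℕ} (P : Fin n → Bool) → Enumeration P
enumerate {zero}  P = (λ ()) , (λ ()) , λ { {()} }
enumerate {suc n} P with P zero in p₀ | enumerate (P ∘ suc)
... | false | e , inP , inj = suc ∘ e , inP , inj ∘ Fin.suc-injective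
... | true  | e , inP , inj = e′ , inP′ , inj′
  where
  e′ : Fin (suc (count (P ∘ suc))) → Fin (suc n)
  e′ zero    = zero
  e′ (suc i) = suc (e i)
  inP′ : ∀ i → T (P (e′ i))
  inP′ zero    = subst T (sym p₀) _
  inP′ (suc i) = inP i
  inj′ : ∀ {i j} → e′ i ≡ e′ j → i ≡ j
  inj′ {zero}  {zero}  _  = refl
  inj′ {suc i} {suc j} eq = cong suc (inj (Fin.suc-injective eq))

count-injective : {n m : ℕ} (P : Fin n → Bool) (g : Fin n → Fin m) →
  (∀ x y → T (P x) → T (P y) → g x ≡ g y → x ≡ y) → count P ≤ m
count-injective P g inj with enumerate P
... | e , inP , e-inj = Fin.injective⇒≤ λ {i} {j} eq → e-inj (inj (e i) (e j) (inP i) (inP j) eq)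

∣p∪⁅y⁆∣ : {n : ℕ} (p : Subset n) (y : Fin n) → y ∉ p → ∣ p ∪ ⁅ y ⁆ ∣ ≡ suc ∣ p ∣
∣p∪⁅y⁆∣ (inside  ∷ p) zero    y∉p = contradiction here y∉p
∣p∪⁅y⁆∣ (outside ∷ p) zero    y∉p = cong (suc ∘ ∣_∣) (∪-identityʳ p)
∣p∪⁅y⁆∣ (inside  ∷ p) (suc y) y∉p = cong suc (∣p∪⁅y⁆∣ p y (y∉p ∘ there))
∣p∪⁅y⁆∣ (outside ∷ p) (suc y) y∉p = ∣p∪⁅y⁆∣ p y (y∉p ∘ there)

Increments : {t : ℕ} → Vector ℕ t → Fin t → Vector ℕ t → Set
Increments w′ i w = w i ≡ suc (w′ i) × (∀ j → j ≢ i → w j ≡ w′ j)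

extend : {n t : ℕ} → Vector (Subset n) t → Fin t → Fin n → Vector (Subset n) t
extend C i y = updateAt C i (_∪ ⁅ y ⁆)

module _ {n t : ℕ} (C : Vector (Subset n) t) (i : Fin t) (y : Fin n) where

  extend-⊇ : ∀ a {x} → x ∈ C a → x ∈ extend C i y a
  extend-⊇ a {x} x∈C with a ≟ i
  ... | yes refl = subst (x ∈_) (sym (updateAt-updates i C)) (x∈p∪q⁺ (inj₁ x∈C))
  ... | no  a≢i  = subst (x ∈_) (sym (updateAt-minimal a i C a≢i)) x∈C

  extend-new : y ∈ extend C i y i
  extend-new = subst (y ∈_) (sym (updateAt-updates i C)) (x∈p∪q⁺ (inj₂ (x∈⁅x⁆ y)))

  extend-∈ : ∀ a {x} → x ∈ extend C i y a → (a ≡ i × x ≡ y) ⊎ x ∈ C a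
  extend-∈ a {x} x∈E with a ≟ i
  ... | no  a≢i  = inj₂ (subst (x ∈_) (updateAt-minimal a i C a≢i) x∈E)
  ... | yes refl with x∈p∪q⁻ (C i) ⁅ y ⁆ (subst (x ∈_) (updateAt-updates i C) x∈E)
  ...   | inj₁ x∈C = inj₂ x∈C
  ...   | inj₂ x∈y = inj₁ (refl , x∈⁅y⁆⇒x≡y y x∈y)

  module _ (fresh : ∀ a → y ∉ C a) where

    extend-disjoint : PairwiseDisjoint C → PairwiseDisjoint (extend C i y)
    extend-disjoint disj a b a≢b x x∈a x∈b with extend-∈ a x∈a | extend-∈ b x∈b
    ... | inj₁ (refl , _)    | inj₁ (refl , _)    = a≢b refl
    ... | inj₁ (_ , refl)    | inj₂ y∈b           = fresh b y∈b
    ... | inj₂ y∈a           | inj₁ (_ , refl)    = fresh a y∈a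
    ... | inj₂ x∈Ca          | inj₂ x∈Cb          = disj a b a≢b x x∈Ca x∈Cb

    extend-sizes : {w′ w : Vector ℕ t} → HasSizes C w′ → Increments w′ i w → HasSizes (extend C i y) w
    extend-sizes {w′} {w} sizes (wᵢ , wⱼ) a with a ≟ i
    ... | yes refl = begin
      ∣ extend C i y i ∣  ≡⟨ cong ∣_∣ (updateAt-updates i C) ⟩
      ∣ C i ∪ ⁅ y ⁆ ∣      ≡⟨ ∣p∪⁅y⁆∣ (C i) y (fresh i) ⟩
      suc ∣ C i ∣          ≡⟨ cong suc (sizes i) ⟩
      suc (w′ i)           ≡⟨ sym wᵢ ⟩
      w i                  ∎
      where open ≡-Reasoning
    ... | no a≢i = trans (cong ∣_∣ (updateAt-minimal a i C a≢i)) (trans (sizes a) (sym (wⱼ a a≢i)))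

separates-⊆ : {n q t : ℕ} (f : Fin n → Fin q) {C C′ : Vector (Subset n) t} →
  (∀ a {x} → x ∈ C a → x ∈ C′ a) → Separates f C′ → Separates f C
separates-⊆ f C⊆C′ sep a b a≢b x y x∈a y∈b = sep a b a≢b x y (C⊆C′ a x∈a) (C⊆C′ b y∈b)

sumV-cong : {t : ℕ} {v w : Vector ℕ t} → (∀ j → v j ≡ w j) → sumV v ≡ sumV w
sumV-cong {zero}  eq = refl
sumV-cong {suc t} eq = cong₂ _+_ (eq zero) (sumV-cong (eq ∘ suc))

sumV-increment : {t : ℕ} {w′ w : Vector ℕ t} {i : Fin t} → Increments w′ i w → sumV w ≡ suc (sumV w′)
sumV-increment {suc t} {i = zero}  (wᵢ , wⱼ) =
  cong₂ _+_ wᵢ (sumV-cong λ j → wⱼ (suc j) λ ())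
sumV-increment {suc t} {w′} {w} {i = suc i} (wᵢ , wⱼ) = begin
  w zero + sumV (w ∘ suc)          ≡⟨ cong₂ _+_ (wⱼ zero λ ()) (sumV-increment tail-increments) ⟩
  w′ zero + suc (sumV (w′ ∘ suc))  ≡⟨ +-suc (w′ zero) _ ⟩
  suc (sumV w′)                    ∎
  where
  open ≡-Reasoning
  tail-increments : Increments (w′ ∘ suc) i (w ∘ suc)
  tail-increments = wᵢ , λ j j≢i → wⱼ (suc j) (j≢i ∘ Fin.suc-injective)

part≤sumV : {t : ℕ} (w : Vector ℕ t) (i : Fin t) → w i ≤ sumV w
part≤sumV w zero    = m≤m+n (w zero) _
part≤sumV w (suc i) = ≤-trans (part≤sumV (w ∘ suc) i) (m≤n+m _ (w zero))

nonempty-part : {t : ℕ} (w : Vector ℕ t) → 1 ≤ sumV w → ∃ λ i → 1 ≤ w i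
nonempty-part {suc t} w pos with w zero in w₀
... | suc _ = zero , subst (1 ≤_) (sym w₀) (s≤s z≤n)
... | zero  with nonempty-part (w ∘ suc) pos
...   | i , wᵢ = suc i , wᵢ

shrink : {t : ℕ} → Vector ℕ t → Fin t → Vector ℕ t
shrink w i = updateAt w i pred

shrink-at : {t : ℕ} (w : Vector ℕ t) (i : Fin t) → shrink w i i ≡ pred (w i)
shrink-at w i = updateAt-updates i w

shrink-off : {t : ℕ} (w : Vector ℕ t) {i j : Fin t} → j ≢ i → shrink w i j ≡ w j
shrink-off w {i} {j} j≢i = updateAt-minimal j i w j≢i

shrink-increments : {t : ℕ} (w : Vector ℕ t) (i : Fin t) → 1 ≤ w i → Increments (shrink w i) i w
shrink-increments w i wᵢ with w i in eq
... | suc c = cong suc (sym (trans (shrink-at w i) (cong pred eq))) , λ j j≢i → sym (shrink-off w j≢i)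

shrink-≤ : {t : ℕ} (w : Vector ℕ t) (i j : Fin t) → shrink w i j ≤ w j
shrink-≤ w i j with j ≟ i
... | yes refl = subst (_≤ w i) (sym (shrink-at w i)) pred[n]≤n
... | no  j≢i  = subst (_≤ w j) (sym (shrink-off w j≢i)) ≤-refl

shrink-nonempty : {t : ℕ} (w : Vector ℕ t) (i c : Fin t) → 1 ≤ w c → (i ≡ c → 1 ≤ pred (w c)) →
  1 ≤ shrink w i c
shrink-nonempty w i c w꜀ last with i ≟ c
... | yes refl = subst (1 ≤_) (sym (shrink-at w i)) (last refl)
... | no  i≢c  = subst (1 ≤_) (sym (shrink-off w (i≢c ∘ sym))) w꜀

-- A type with two different nonempty parts, the types for which separation is a real condition.
record TwoParts {t : ℕ} (w : Vector ℕ t) : Set where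
  field
    first second    : Fin t
    distinct        : first ≢ second
    first-nonempty  : 1 ≤ w first
    second-nonempty : 1 ≤ w second

nonempty-part-other-than : {t : ℕ} {w : Vector ℕ t} → TwoParts w → (i : Fin t) → ∃ λ k → k ≢ i × 1 ≤ w k
nonempty-part-other-than record { first = a ; second = b ; distinct = a≢b
                               ; first-nonempty = wₐ ; second-nonempty = w_b } i with a ≟ i
... | yes refl = b , a≢b ∘ sym , w_b
... | no  a≢i  = a , a≢i , wₐ

removable : {t : ℕ} (w : Vector ℕ t) → TwoParts w → 3 ≤ sumV w → ∃ λ i → 1 ≤ w i × TwoParts (shrink w i)
removable w tp big = i , ≤-trans restᵢ (≤-trans (shrink-≤ _ b i) (shrink-≤ w a i)) , record
  { first = a ; second = b ; distinct = distinct
  ; first-nonempty  = shrink-nonempty w i a first-nonempty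
                        λ i≡a → subst (1 ≤_) restₐ (subst (λ c → 1 ≤ rest c) i≡a restᵢ)
  ; second-nonempty = shrink-nonempty w i b second-nonempty
                        λ i≡b → subst (1 ≤_) rest-b (subst (λ c → 1 ≤ rest c) i≡b restᵢ) }
  where
  open TwoParts tp renaming (first to a; second to b)
  rest : Vector ℕ _
  rest = shrink (shrink w a) b
  b-in-shrink : 1 ≤ shrink w a b
  b-in-shrink = subst (1 ≤_) (sym (shrink-off w (distinct ∘ sym))) second-nonempty
  rest-size : sumV w ≡ suc (suc (sumV rest))
  rest-size = trans (sumV-increment (shrink-increments w a first-nonempty))
                    (cong suc (sumV-increment (shrink-increments (shrink w a) b b-in-shrink)))
  -- some part of rest is nonempty; removing an element there keeps parts a and b nonempty
  rest-part = nonempty-part rest (≤-pred (≤-pred (subst (3 ≤_) rest-size big)))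
  i = proj₁ rest-part
  restᵢ = proj₂ rest-part
  restₐ : rest a ≡ pred (w a)
  restₐ = trans (shrink-off (shrink w a) distinct) (shrink-at w a)
  rest-b : rest b ≡ pred (w b)
  rest-b = trans (shrink-at (shrink w a) b) (cong pred (shrink-off w (distinct ∘ sym)))

singleton-type : {t : ℕ} (w : Vector ℕ t) (k : Fin t) → sumV w ≡ 1 → 1 ≤ w k → Increments (λ _ → 0) k w
singleton-type w k size wₖ = trans wₖ≡ (cong suc (empty k)) , λ j j≢k → trans (proj₂ inc j j≢k) (empty j)
  where
  inc = shrink-increments w k wₖ
  wₖ≡ = proj₁ inc
  rest-size : sumV (shrink w k) ≡ 0
  rest-size = suc-injective (trans (sym (sumV-increment inc)) size)
  empty : ∀ j → shrink w k j ≡ 0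
  empty j = n≤0⇒n≡0 (subst (shrink w k j ≤_) rest-size (part≤sumV (shrink w k) j))

Inside : {n t : ℕ} → Vector (Subset n) t → (Fin n → Bool) → Set
Inside C P = ∀ a {x} → x ∈ C a → T (P x)

IsSHFOn : {N n q t : ℕ} → HashFamily N n q → (Fin n → Bool) → Vector ℕ t → Set
IsSHFOn {N} {n} {q} {t} F P w =
  (C : Vector (Subset n) t) → PairwiseDisjoint C → HasSizes C w → Inside C P →
  ∃ λ (k : Fin N) → Separates (F k) C

module Representatives {n m : ℕ} (P : Fin n → Bool) (code : Fin n → Fin m) where

  Fibre : Fin m → Set
  Fibre c = ∃ λ y → T (P y) × code y ≡ c

  fibre? : (c : Fin m) → Dec (Fibre c)
  fibre? c = Fin.any? λ y → T? (P y) ×-dec (code y Fin.≟ c)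

  pick : (c : Fin m) → Fin n → Dec (Fibre c) → Fin n
  pick c x (yes (y , _)) = y
  pick c x (no _)        = x

  pick-default : (c : Fin m) (x x′ : Fin n) (d : Dec (Fibre c)) → Fibre c → pick c x d ≡ pick c x′ d
  pick-default c x x′ (yes _)   _ = refl
  pick-default c x x′ (no none) y = contradiction y none

  pick-in-fibre : (c : Fin m) (x : Fin n) (d : Dec (Fibre c)) → Fibre c →
    T (P (pick c x d)) × code (pick c x d) ≡ c
  pick-in-fibre c x (yes (y , py , cy)) _ = py , cy
  pick-in-fibre c x (no none)           y = contradiction y none

  canon : Fin n → Fin n
  canon x = pick (code x) x (fibre? (code x))

  canon-fibre : ∀ x → T (P x) → T (P (canon x)) × code (canon x) ≡ code x
  canon-fibre x px = pick-in-fibre (code x) x (fibre? (code x)) (x , px , refl)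

  canon-cong : ∀ x x′ → T (P x) → code x ≡ code x′ → canon x ≡ canon x′
  canon-cong x x′ px eq rewrite eq = pick-default (code x′) x x′ (fibre? (code x′)) (x , px , eq)

  Canonical Duplicate : Fin n → Bool
  Canonical x = P x ∧ isYes (x ≟ canon x)
  Duplicate x = P x ∧ not (isYes (x ≟ canon x))

  canonical-spec : ∀ x → T (Canonical x) → T (P x) × x ≡ canon x
  canonical-spec x c with Equivalence.to (T-∧ {P x} {isYes (x ≟ canon x)}) c
  ... | px , e = px , toWitness {a? = x ≟ canon x} e

  duplicate-spec : ∀ x → T (Duplicate x) → T (P x) × x ≢ canon x
  duplicate-spec x d with Equivalence.to (T-∧ {P x} {not (isYes (x ≟ canon x))}) d
  ... | px , ne = px , toWitnessFalse {a? = x ≟ canon x} ne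

  canon-not-duplicate : ∀ x → T (P x) → ¬ T (Duplicate (canon x))
  canon-not-duplicate x px dup = proj₂ (duplicate-spec (canon x) dup)
    (canon-cong x (canon x) px (sym (proj₂ (canon-fibre x px))))

  canonical-or-duplicate : ∀ x → T (P x) → T (Canonical x) ⊎ T (Duplicate x)
  canonical-or-duplicate x px with x ≟ canon x
  ... | yes _ = inj₁ (Equivalence.from (T-∧ {P x} {true}) (px , _))
  ... | no  _ = inj₂ (Equivalence.from (T-∧ {P x} {true}) (px , _))

  canonical-injective : ∀ x y → T (Canonical x) → T (Canonical y) → code x ≡ code y → x ≡ y
  canonical-injective x y cx cy eq = begin
    x        ≡⟨ proj₂ (canonical-spec x cx) ⟩
    canon x  ≡⟨ canon-cong x y (proj₁ (canonical-spec x cx)) eq ⟩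
    canon y  ≡⟨ proj₂ (canonical-spec y cy) ⟨
    y        ∎
    where open ≡-Reasoning

  count-representatives : count P ≤ m + count Duplicate
  count-representatives = ≤-trans (count-cover P Canonical Duplicate canonical-or-duplicate)
    (+-monoˡ-≤ (count Duplicate) (count-injective Canonical code canonical-injective))

element-of : {n : ℕ} (p : Subset n) → 1 ≤ ∣ p ∣ → ∃ λ x → x ∈ p
element-of {n} p size with nonempty? p
... | yes ne    = ne
... | no  empty = contradiction (subst (1 ≤_) (trans (cong ∣_∣ (Empty-unique empty)) (∣⊥∣≡0 n)) size) λ ()

module Blocks (b M : ℕ) {n q : ℕ} (F : HashFamily (b + M) n q) where

  block-code : Fin n → Fin (q ^ b)
  block-code x = funToFin λ c → F (c ↑ˡ M) x

  block-code-agrees : ∀ {x y} → block-code x ≡ block-code y → ∀ c → F (c ↑ˡ M) x ≡ F (c ↑ˡ M) y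
  block-code-agrees {x} {y} eq c = begin
    F (c ↑ˡ M) x              ≡⟨ Fin.finToFun-funToFin (λ c → F (c ↑ˡ M) x) c ⟨
    finToFun (block-code x) c ≡⟨ cong (λ u → finToFun u c) eq ⟩
    finToFun (block-code y) c ≡⟨ Fin.finToFun-funToFin (λ c → F (c ↑ˡ M) y) c ⟩
    F (c ↑ˡ M) y              ∎
    where open ≡-Reasoning

  tail-rows : HashFamily M n q
  tail-rows c = F (b ↑ʳ c)

  shf-step : {t : ℕ} (P : Fin n → Bool) {w′ w : Vector ℕ t} {i k : Fin t} →
    Increments w′ i w → k ≢ i → 1 ≤ w′ k → IsSHFOn F P w →
    IsSHFOn tail-rows (Representatives.Duplicate P block-code) w′
  shf-step P {i = i} {k} inc k≢i w′ₖ shf D disj sizes dups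
    with element-of (D k) (subst (1 ≤_) (sym (sizes k)) w′ₖ)
  ... | z , z∈D =
    separated (shf E (extend-disjoint D i y fresh disj) (extend-sizes D i y fresh sizes inc) inside-E)
    where
    open Representatives P block-code
    pz = proj₁ (duplicate-spec z (dups k z∈D))
    y = canon z
    fresh : ∀ a → y ∉ D a
    fresh a y∈D = canon-not-duplicate z pz (dups a y∈D)
    E = extend D i y
    inside-E : Inside E P
    inside-E a x∈E with extend-∈ D i y a x∈E
    ... | inj₁ (_ , refl) = proj₁ (canon-fibre z pz)
    ... | inj₂ x∈D        = proj₁ (duplicate-spec _ (dups a x∈D))
    separated : (∃ λ row → Separates (F row) E) → ∃ λ c → Separates (tail-rows c) D
    separated (row , sep) with splitAt b row in eq
    ... | inj₁ c = contradiction
            (subst (λ r → F r y ≡ F r z) (Fin.splitAt⁻¹-↑ˡ eq) (block-code-agrees (proj₂ (canon-fibre z pz)) c))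
            (sep i k (k≢i ∘ sym) y z (extend-new D i y) (extend-⊇ D i y k z∈D))
    ... | inj₂ c = c , separates-⊆ (tail-rows c) (extend-⊇ D i y)
                         (subst (λ r → Separates (F r) E) (sym (Fin.splitAt⁻¹-↑ʳ eq)) sep)

shf-no-rows : {n q t : ℕ} (F : HashFamily 0 n q) (P : Fin n → Bool) {w : Vector ℕ t} {k : Fin t} →
  Increments (λ _ → 0) k w → IsSHFOn F P w → count P ≡ 0
shf-no-rows {n} F P {k = k} single shf = count-none P λ z pz →
  Fin.¬Fin0 (proj₁ (shf (extend (λ _ → ⊥) k z) (extend-disjoint none k z (λ _ → ∉⊥) none-disjoint)
                        (extend-sizes none k z (λ _ → ∉⊥) (λ _ → ∣⊥∣≡0 n) single) (inside-P z pz)))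
  where
  none : Vector (Subset _) _
  none _ = ⊥
  none-disjoint : PairwiseDisjoint none
  none-disjoint _ _ _ _ x∈⊥ _ = ∉⊥ x∈⊥
  inside-P : ∀ z → T (P z) → Inside (extend none k z) P
  inside-P z pz a x∈E with extend-∈ none k z a x∈E
  ... | inj₁ (_ , refl) = pz
  ... | inj₂ x∈⊥        = contradiction x∈⊥ ∉⊥

-- Each block costs q ^ (its size) for
-- the representatives of its codes and one element of the type (shf-step); when a single
-- element is left, the remaining points cannot be separated by zero rows (shf-no-rows).
shf-bound-on : {n q t : ℕ} (b : ℕ) (bs : List ℕ) (w : Vector ℕ t) → TwoParts w →
  sumV w ≡ 2 + length bs → (F : HashFamily (sum (b ∷ bs)) n q) (P : Fin n → Bool) →
  IsSHFOn F P w →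
  count P ≤ sum (map (q ^_) (b ∷ bs))
shf-bound-on {q = q} b [] w tp size F P shf = begin
  count P                  ≤⟨ count-representatives ⟩
  q ^ b + count Duplicate  ≡⟨ cong (q ^ b +_) (shf-no-rows tail-rows Duplicate single
                                (shf-step P inc (distinct ∘ sym) second-nonempty′ shf)) ⟩
  q ^ b + 0                ∎
  where
  open Blocks b 0 F
  open Representatives P block-code
  open TwoParts tp
  open ≤-Reasoning
  inc = shrink-increments w first first-nonempty
  second-nonempty′ : 1 ≤ shrink w first second
  second-nonempty′ = subst (1 ≤_) (sym (shrink-off w (distinct ∘ sym))) second-nonempty
  single = singleton-type (shrink w first) second (suc-injective (trans (sym (sumV-increment inc)) size))
                          second-nonempty′
shf-bound-on {q = q} b (b′ ∷ bs) w tp size F P shf = begin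
  count P                           ≤⟨ count-representatives ⟩
  q ^ b + count Duplicate           ≤⟨ +-monoʳ-≤ (q ^ b) induction-hypothesis ⟩
  q ^ b + sum (map (q ^_) (b′ ∷ bs)) ∎
  where
  open Blocks b (sum (b′ ∷ bs)) F
  open Representatives P block-code
  open ≤-Reasoning
  removal = removable w tp (subst (3 ≤_) (sym size) (s≤s (s≤s (s≤s z≤n))))
  i = proj₁ removal
  w′ = shrink w i
  inc = shrink-increments w i (proj₁ (proj₂ removal))
  tp′ = proj₂ (proj₂ removal)
  other = nonempty-part-other-than tp′ i
  shf′ = shf-step P inc (proj₁ (proj₂ other)) (proj₂ (proj₂ other)) shf
  size′ = suc-injective (trans (sym (sumV-increment inc)) size)
  induction-hypothesis = shf-bound-on b′ bs w′ tp′ size′ tail-rows Duplicate shf′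

shf-bound : {n q t : ℕ} (b : ℕ) (bs : List ℕ) (w : Vector ℕ t) → TwoParts w →
  sumV w ≡ 2 + length bs → (F : HashFamily (sum (b ∷ bs)) n q) → IsSHF F w →
  n ≤ sum (map (q ^_) (b ∷ bs))
shf-bound {n} b bs w tp size F shf =
  subst (_≤ _) (count-all n)
    (shf-bound-on b bs w tp size F (λ _ → true) λ C disj sizes _ → shf C disj sizes)

[k*L+j]/L≡k : (k j L : ℕ) .{{_ : NonZero L}} → j < L → (k * L + j) / L ≡ k
[k*L+j]/L≡k k j L j<L = begin
  (k * L + j) / L      ≡⟨ +-distrib-/-∣ˡ j (n∣m*n k) ⟩
  k * L / L + j / L    ≡⟨ cong₂ _+_ (m*n/n≡m k L) (m<n⇒m/n≡0 j<L) ⟩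
  k + 0                ≡⟨ +-identityʳ k ⟩
  k                    ∎
  where open ≡-Reasoning

balanced-split : (N L r : ℕ) .{{_ : NonZero L}} → 1 ≤ r → r ≤ L → N % L ≡ r % L →
  r * ceilDiv N L + (L ∸ r) * (N / L) ≡ N
balanced-split N L@(suc ℓ) r@(suc r′) _ r≤L N≡r with m≤n⇒m<n∨m≡n r≤L
... | inj₁ r<L = begin
  r * ceilDiv N L + (L ∸ r) * a   ≡⟨ cong (λ c → r * c + (L ∸ r) * a) ceil≡ ⟩
  r * suc a + (L ∸ r) * a         ≡⟨ ring₂ r a (L ∸ r) ⟩
  r + a * (r + (L ∸ r))           ≡⟨ cong (λ m → r + a * m) (m+[n∸m]≡n r≤L) ⟩
  r + a * L                       ≡⟨ N≡ ⟨
  N                               ∎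
  where
  open ≡-Reasoning
  a = N / L
  N≡ : N ≡ r + a * L
  N≡ = trans (m≡m%n+[m/n]*n N L) (cong (_+ a * L) (trans N≡r (m<n⇒m%n≡m r<L)))
  ring₁ : ∀ r′ a ℓ → suc r′ + a * suc ℓ + ℓ ≡ suc a * suc ℓ + r′
  ring₁ = solve-∀
  ring₂ : ∀ r a d → r * suc a + d * a ≡ r + a * (r + d)
  ring₂ = solve-∀
  ceil≡ : ceilDiv N L ≡ suc a
  ceil≡ = trans (cong (λ m → (m + ℓ) / L) N≡)
            (trans (cong (_/ L) (ring₁ r′ a ℓ)) ([k*L+j]/L≡k (suc a) r′ L (<-trans (n<1+n r′) r<L)))
... | inj₂ refl = begin
  L * ceilDiv N L + (L ∸ L) * a   ≡⟨ cong₂ (λ c z → L * c + z * a) ceil≡ (n∸n≡0 L) ⟩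
  L * a + 0                       ≡⟨ +-identityʳ (L * a) ⟩
  L * a                           ≡⟨ *-comm L a ⟩
  a * L                           ≡⟨ N≡ ⟨
  N                               ∎
  where
  open ≡-Reasoning
  a = N / L
  N≡ : N ≡ a * L
  N≡ = trans (m≡m%n+[m/n]*n N L) (cong (_+ a * L) (trans N≡r (n%n≡0 L)))
  ceil≡ : ceilDiv N L ≡ a
  ceil≡ = trans (cong (λ m → (m + ℓ) / L) N≡) ([k*L+j]/L≡k a ℓ L (n<1+n ℓ))

sum-replicate : (k x : ℕ) → sum (replicate k x) ≡ k * x
sum-replicate zero    x = refl
sum-replicate (suc k) x = cong (x +_) (sum-replicate k x)

sum-two-values : (r s c a : ℕ) → sum (replicate r c ++ replicate s a) ≡ r * c + s * a
sum-two-values r s c a = trans (sum-++ (replicate r c) _) (cong₂ _+_ (sum-replicate r c) (sum-replicate s a))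

map-two-values : (f : ℕ → ℕ) (r s c a : ℕ) →
  map f (replicate r c ++ replicate s a) ≡ replicate r (f c) ++ replicate s (f a)
map-two-values f r s c a =
  trans (map-++ f (replicate r c) _) (cong₂ _++_ (map-replicate f r c) (map-replicate f s a))

reindex : {M N n q t : ℕ} {w : Vector ℕ t} → M ≡ N → (F : HashFamily N n q) → IsSHF F w →
  Σ (HashFamily M n q) λ G → IsSHF G w
reindex refl F shf = F , shf

theorem1p6 : (N q t : ℕ) → (w : Vector ℕ t) → 2 ≤ N → 2 ≤ q → 2 ≤ t →
    ((i : Fin t) → 1 ≤ w i) → t ≤ q →
    .{{_ : NonZero (sumV w ∸ 1)}} →
    (r : ℕ) → 1 ≤ r → r ≤ sumV w ∸ 1 → N % (sumV w ∸ 1) ≡ r % (sumV w ∸ 1) →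
    (n : ℕ) → (F : HashFamily N n q) → IsSHF F w →
    (∃ λ (m : ℕ) → (sumV w ≤ m) × Σ (HashFamily (N / (sumV w ∸ 1)) m q) (λ G → IsSHF G w)) →
    n ≤ r * q ^ ceilDiv N (sumV w ∸ 1) + ((sumV w ∸ 1) ∸ r) * q ^ (N / (sumV w ∸ 1))
-- Theorem 1.6: the bound for the balanced split of the N rows.
theorem1p6 N q (suc (suc t)) w _ _ (s≤s (s≤s _)) w≥1 _ r@(suc r′) r≥1 r≤L N≡r n F shf _ = begin
  n                                                      ≤⟨ shf-bound c rest w two-parts type-size G G-shf ⟩
  sum (map (q ^_) blocks)                                ≡⟨ cong sum (map-two-values (q ^_) r (L ∸ r) c a) ⟩
  sum (replicate r (q ^ c) ++ replicate (L ∸ r) (q ^ a)) ≡⟨ sum-two-values r (L ∸ r) (q ^ c) (q ^ a) ⟩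
  r * q ^ c + (L ∸ r) * q ^ a                            ∎
  where
  open ≤-Reasoning
  L = sumV w ∸ 1
  c = ceilDiv N L
  a = N / L
  blocks rest : List ℕ
  blocks = replicate r c ++ replicate (L ∸ r) a
  rest   = replicate r′ c ++ replicate (L ∸ r) a
  G-rows = reindex (trans (sum-two-values r (L ∸ r) c a) (balanced-split N L r r≥1 r≤L N≡r)) F shf
  G = proj₁ G-rows
  G-shf = proj₂ G-rows
  two-parts : TwoParts w
  two-parts = record { first = zero ; second = suc zero ; distinct = λ ()
                     ; first-nonempty = w≥1 zero ; second-nonempty = w≥1 (suc zero) }
  rest-length : length rest ≡ r′ + (L ∸ r)
  rest-length = trans (length-++ (replicate r′ c)) (cong₂ _+_ (length-replicate r′) (length-replicate (L ∸ r)))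
  type-size : sumV w ≡ 2 + length rest
  type-size = begin-equality
    sumV w                ≡⟨ suc-pred (sumV w) {{>-nonZero (≤-trans (w≥1 zero) (part≤sumV w zero))}} ⟨
    suc L                 ≡⟨ cong suc (m+[n∸m]≡n r≤L) ⟨
    suc (r + (L ∸ r))     ≡⟨ cong (2 +_) rest-length ⟨
    2 + length rest       ∎
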